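{- Let $G$ be a cubic graph on $n \ge 8$ vertices that has a self-identifying code. Then $\mathrm{SIC}(G) = n$ if and only if $V(G)$ can be partitioned into sets of three vertices each of which induces a triangle.
   Context: All graphs are finite, simple, undirected and connected; a cubic graph is 3-regular. $N[v] = N(v) \cup \{v\}$; $N_S[v] = N[v] \cap S$. A set $S \subseteq V(G)$ is a self-identifying code (SIC) if for every $x \in V(G)$, $N_S[x] \neq \varnothing$ and $\bigcap_{v \in N_S[x]} N[v] = \{x\}$; $\mathrm{SIC}(G)$ is the minimum cardinality of an SIC. -}

module Defs where

open import Data.Nat using (ℕ; _≤_)
open import Data.Bool using (Bool; true; false; _∨_; T)
open import Data.Fin using (Fin; _≟_)
open import Data.Fin.Subset using (Subset; _∈_; _∩_; ∣_∣)
open import Data.Vec using (tabulate)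
open import Data.Product using (Σ; ∃; _×_; _,_)
open import Relation.Binary.PropositionalEquality using (_≡_; _≢_)
open import Relation.Nullary using (¬_)
open import Relation.Nullary.Decidable using (⌊_⌋)
open import Function.Bundles using (_⇔_)

record Graph (n : ℕ) : Set where
  field
    adj    : Fin n → Fin n → Bool
    sym    : ∀ u v → adj u v ≡ adj v u
    irrefl : ∀ v → adj v v ≡ false

module _ {n : ℕ} (G : Graph n) where
  open Graph G

  Adj : Fin n → Fin n → Set
  Adj u v = T (adj u v)

  data Reach : Fin n → Fin n → Set where
    here : ∀ {u} → Reach u u
    step : ∀ {u w v} → Adj u w → Reach w v → Reach u v

  Connected : Set
  Connected = ∀ u v → Reach u v

  N : Fin n → Subset n
  N v = tabulate (λ u → adj v u)

  N[_] : Fin n → Subset n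
  N[ v ] = tabulate (λ u → adj v u ∨ ⌊ u ≟ v ⌋)

  Cubic : Set
  Cubic = ∀ v → ∣ N v ∣ ≡ 3

  NS[_] : Subset n → Fin n → Subset n
  NS[ S ] x = N[ x ] ∩ S

  IsSIC : Subset n → Set
  IsSIC S = ∀ x →
    (∃ λ v → v ∈ NS[ S ] x) ×
    (∀ y → ((∀ v → v ∈ NS[ S ] x → y ∈ N[ v ]) ⇔ (y ≡ x)))

  HasSIC : Set
  HasSIC = ∃ λ S → IsSIC S

  IsSICNumber : ℕ → Set
  IsSICNumber k = (∃ λ S → IsSIC S × ∣ S ∣ ≡ k) × (∀ S → IsSIC S → k ≤ ∣ S ∣)

  TrianglePartition : Set
  TrianglePartition =
    Σ ℕ λ m → Σ (Fin m → Subset n) λ B →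
      (∀ v → ∃ λ i → v ∈ B i) ×
      (∀ v i j → v ∈ B i → v ∈ B j → i ≡ j) ×
      (∀ i → ∣ B i ∣ ≡ 3) ×
      (∀ i u w → u ∈ B i → w ∈ B i → u ≢ w → Adj u w)

-- If V(G) splits into triangles, no code S can omit a vertex v: v has a neighbour u outside
-- its own triangle, and if v ∉ S then every codeword in N[u] lies in u's triangle {u, w, w'},
-- so w lies in all their closed neighbourhoods and u is not identified.
--
-- Conversely, SIC(G) = n makes V(G) itself a code, so closed neighbourhoods are pairwise
-- incomparable: adjacent vertices have at most one common neighbour, and each vertex lies in
-- at most one triangle. By minimality every v is essential: V(G) − v is not a code, so some
-- x ≠ y has N[x] − v ⊆ N[y]. If x ∼ y, then v is adjacent to a triangle x y p avoiding v;
-- otherwise x = v and y is an open twin of v. Either way, lying in a triangle propagates along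
-- every edge (a twin of a triangle vertex would form a diamond), so by connectivity either
-- every vertex lies in a triangle or none does. In the latter case every vertex has a twin,
-- which forces G = K₃,₃, contradicting n ≥ 8. The unique triangles through the vertices then
-- partition V(G).

module Submission where

open import Defs
open import Data.Bool using (Bool; T; _∨_)
open import Data.Bool.Properties using (T?; T-≡; T-∨)
open import Data.Empty using (⊥; ⊥-elim)
open import Data.Fin using (Fin; zero; suc; _≟_; toℕ; fromℕ<; inject)
open import Data.Fin.Properties using (any?; all?; toℕ-injective; toℕ-inject; toℕ-fromℕ<; ¬∀⟶∃¬-smallest)
open import Data.Fin.Subset using (Subset; _∈_; _∉_; _⊆_; _-_; ∣_∣; ⁅_⁆; ⊤; Nonempty; inside; outside)
open import Data.Fin.Subset.Properties
  using ( _∈?_; _⊆?_; ⊆-antisym; ⊆⊤; ∣p∣≡n⇒p≡⊤; ∣⊤∣≡n; ∈⊤; x∈p∩q⁺; x∈p∩q⁻; p─⊥≡p; p─q⊆p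
        ; x∈p∧x≢y⇒x∈p-y; x∈p⇒∣p-x∣<∣p∣; p⊆q⇒∣p∣≤∣q∣; Empty-unique; ∣⊥∣≡0)
open import Data.List using (List; []; _∷_; _++_; length; filter; allFin; lookup)
open import Data.List.Membership.Propositional using () renaming (_∈_ to _∈ₗ_)
open import Data.List.Membership.Propositional.Properties using (∈-filter⁺; ∈-filter⁻; ∈-allFin; ∈-lookup)
open import Data.List.Relation.Unary.All as All using (All; []; _∷_)
open import Data.List.Relation.Unary.Any as Any using (here; there; tail; index)
open import Data.List.Relation.Unary.Any.Properties using (lookup-index; ++⁺ˡ; ++⁺ʳ)
open import Data.List.Relation.Unary.AllPairs using ([]; _∷_)
open import Data.List.Relation.Unary.Unique.Propositional using (Unique)
open import Data.List.Relation.Unary.Unique.Propositional.Properties using (filter⁺; allFin⁺)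
open import Data.Nat using (ℕ; suc; _≤_; _<_; z≤n; s≤s; _≤?_)
open import Data.Nat.Properties
  using (≤-refl; ≤-trans; ≤-antisym; ≤-reflexive; n≤1+n; suc-injective; <⇒≱; ≤⇒≯; ≮⇒≥)
open import Data.Product using (∃; ∃₂; _×_; _,_; proj₁; proj₂; uncurry)
open import Data.Sum using (_⊎_; inj₁; inj₂; [_,_]′)
open import Data.Vec using (_∷_; here; there; tabulate)
open import Data.Vec.Properties using ([]=⇒lookup; lookup⇒[]=; lookup∘tabulate)
open import Function using (_∘_)
open import Function.Bundles using (_⇔_; Equivalence; mk⇔)
open import Level using (Level)
open import Relation.Binary using (Rel; Decidable; IsEquivalence)
open import Relation.Binary.PropositionalEquality
open import Relation.Nullary using (¬_; Dec; yes; no; contradiction)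
open import Relation.Nullary.Decidable
  using (⌊_⌋; ¬?; _×-dec_; _⊎-dec_; _→-dec_; decidable-stable; toWitness; fromWitness)

private variable
  n : ℕ
  x y z : Fin n
  p q : Subset n
  xs : List (Fin n)

≢⇒Unique₃ : x ≢ y → x ≢ z → y ≢ z → Unique (x ∷ y ∷ z ∷ [])
≢⇒Unique₃ x≢y x≢z y≢z = (x≢y ∷ x≢z ∷ []) ∷ (y≢z ∷ []) ∷ [] ∷ []

x∈tabulate⇒T : ∀ (f : Fin n → Bool) → x ∈ tabulate f → T (f x)
x∈tabulate⇒T {x = x} f x∈ =
  Equivalence.from T-≡ (trans (sym (lookup∘tabulate f x)) ([]=⇒lookup x∈))

T⇒x∈tabulate : ∀ (f : Fin n → Bool) → T (f x) → x ∈ tabulate f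
T⇒x∈tabulate {x = x} f t =
  lookup⇒[]= x (tabulate f) (trans (lookup∘tabulate f x) (Equivalence.to T-≡ t))

x∉p-x : ∀ (x : Fin n) p → x ∉ p - x
x∉p-x zero    (_ ∷ p) ()
x∉p-x (suc x) (_ ∷ p) (there x∈) = x∉p-x x p x∈

x∈p-y⇒x≢y : x ∈ p - y → x ≢ y
x∈p-y⇒x≢y {x = x} {p = p} x∈ refl = x∉p-x x p x∈

x∈p-y⇒x∈p : x ∈ p - y → x ∈ p
x∈p-y⇒x∈p {p = p} {y = y} = p─q⊆p p ⁅ y ⁆

∣p∣≤1+∣p-x∣ : ∀ (p : Subset n) x → ∣ p ∣ ≤ suc ∣ p - x ∣
∣p∣≤1+∣p-x∣ (inside  ∷ p) zero    = s≤s (≤-reflexive (cong ∣_∣ (sym (p─⊥≡p p))))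
∣p∣≤1+∣p-x∣ (outside ∷ p) zero    =
  ≤-trans (n≤1+n ∣ p ∣) (s≤s (≤-reflexive (cong ∣_∣ (sym (p─⊥≡p p)))))
∣p∣≤1+∣p-x∣ (inside  ∷ p) (suc x) = s≤s (∣p∣≤1+∣p-x∣ p x)
∣p∣≤1+∣p-x∣ (outside ∷ p) (suc x) = ∣p∣≤1+∣p-x∣ p x

x∈p∧∣p∣≡1+k⇒∣p-x∣≡k : ∀ {k} → x ∈ p → ∣ p ∣ ≡ suc k → ∣ p - x ∣ ≡ k
x∈p∧∣p∣≡1+k⇒∣p-x∣≡k {x = x} {p = p} x∈p ∣p∣≡1+k =
  suc-injective (trans (≤-antisym (x∈p⇒∣p-x∣<∣p∣ x∈p) (∣p∣≤1+∣p-x∣ p x)) ∣p∣≡1+k)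

∣p∣≡1+k⇒Nonempty : ∀ {k} (p : Subset n) → ∣ p ∣ ≡ suc k → Nonempty p
∣p∣≡1+k⇒Nonempty (inside  ∷ p) _ = zero , here
∣p∣≡1+k⇒Nonempty (outside ∷ p) ∣p∣≡1+k with ∣p∣≡1+k⇒Nonempty p ∣p∣≡1+k
... | x , x∈p = suc x , there x∈p

∣p∣≡3⇒triple : ∣ p ∣ ≡ 3 → x ∈ p → ∃₂ λ y z → Unique (x ∷ y ∷ z ∷ []) × y ∈ p × z ∈ p
∣p∣≡3⇒triple {p = p} {x = x} ∣p∣≡3 x∈p
  with ∣p-x∣≡2 ← x∈p∧∣p∣≡1+k⇒∣p-x∣≡k x∈p ∣p∣≡3
  with y , y∈p-x ← ∣p∣≡1+k⇒Nonempty (p - x) ∣p-x∣≡2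
  with z , z∈p-x-y ← ∣p∣≡1+k⇒Nonempty (p - x - y) (x∈p∧∣p∣≡1+k⇒∣p-x∣≡k y∈p-x ∣p-x∣≡2)
  = y , z , ≢⇒Unique₃ x≢y x≢z y≢z , x∈p-y⇒x∈p y∈p-x , x∈p-y⇒x∈p z∈p-x
  where
  z∈p-x = x∈p-y⇒x∈p z∈p-x-y
  x≢y = x∈p-y⇒x≢y y∈p-x ∘ sym
  y≢z = x∈p-y⇒x≢y z∈p-x-y ∘ sym
  x≢z = x∈p-y⇒x≢y z∈p-x ∘ sym

∣p∣≤length : ∀ {p : Subset n} xs → (∀ {z} → z ∈ p → z ∈ₗ xs) → ∣ p ∣ ≤ length xs
∣p∣≤length {n} {p} [] p⊆[] =
  ≤-reflexive (trans (cong ∣_∣ (Empty-unique λ { (_ , z∈p) → contradiction (p⊆[] z∈p) λ () })) (∣⊥∣≡0 n))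
∣p∣≤length {p = p} (x ∷ xs) p⊆x∷xs = ≤-trans (∣p∣≤1+∣p-x∣ p x) (s≤s (∣p∣≤length xs p-x⊆xs))
  where
  p-x⊆xs : ∀ {z} → z ∈ p - x → z ∈ₗ xs
  p-x⊆xs z∈ = tail (x∈p-y⇒x≢y z∈) (p⊆x∷xs (x∈p-y⇒x∈p z∈))

length≤∣p∣ : Unique xs → All (_∈ p) xs → length xs ≤ ∣ p ∣
length≤∣p∣ [] [] = z≤n
length≤∣p∣ {p = p} (x≢xs ∷ unique) (x∈p ∷ xs⊆p) =
  ≤-trans (s≤s (length≤∣p∣ unique xs⊆p-x)) (x∈p⇒∣p-x∣<∣p∣ x∈p)
  where
  xs⊆p-x = All.zipWith (λ (z∈p , x≢z) → x∈p∧x≢y⇒x∈p-y z∈p (x≢z ∘ sym)) (xs⊆p , x≢xs)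

length≥∣p∣⇒p⊆xs : Unique xs → All (_∈ p) xs → ∣ p ∣ ≤ length xs → z ∈ p → z ∈ₗ xs
length≥∣p∣⇒p⊆xs {xs = xs} {z = z} unique xs⊆p ∣p∣≤ z∈p with Any.any? (z ≟_) xs
... | yes z∈xs = z∈xs
... | no z∉xs = contradiction ∣p∣≤ (<⇒≱ (length≤∣p∣ (z≢xs ∷ unique) (z∈p ∷ xs⊆p)))
  where
  z≢xs : All (z ≢_) xs
  z≢xs = All.tabulate λ { y∈xs refl → z∉xs y∈xs }

p⊆q∧∣q∣≤∣p∣⇒q⊆p : p ⊆ q → ∣ q ∣ ≤ ∣ p ∣ → q ⊆ p
p⊆q∧∣q∣≤∣p∣⇒q⊆p {p = p} {q = q} p⊆q ∣q∣≤∣p∣ {x} x∈q with x ∈? p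
... | yes x∈p = x∈p
... | no x∉p =
  contradiction ∣q∣≤∣p∣ (<⇒≱ (≤-trans (s≤s (p⊆q⇒∣p∣≤∣q∣ p⊆q-x)) (x∈p⇒∣p-x∣<∣p∣ x∈q)))
  where
  p⊆q-x : p ⊆ q - x
  p⊆q-x y∈p = x∈p∧x≢y⇒x∈p-y (p⊆q y∈p) λ { refl → x∉p y∈p }

lookup-injective : Unique xs → ∀ i j → lookup xs i ≡ lookup xs j → i ≡ j
lookup-injective (_    ∷ _)      zero    zero    _  = refl
lookup-injective (x≢xs ∷ _)      zero    (suc j) eq = contradiction eq (All.lookup x≢xs (∈-lookup j))
lookup-injective (x≢xs ∷ _)      (suc i) zero    eq = contradiction (sym eq) (All.lookup x≢xs (∈-lookup i))
lookup-injective (_    ∷ unique) (suc i) (suc j) eq = cong suc (lookup-injective unique i j eq)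

record Transversal {ℓ : Level} (R : Rel (Fin n) ℓ) : Set ℓ where
  field
    size      : ℕ
    rep       : Fin size → Fin n
    covers    : ∀ v → ∃ λ i → R (rep i) v
    separates : ∀ {i j v} → R (rep i) v → R (rep j) v → i ≡ j

module _ {ℓ : Level} {R : Rel (Fin n) ℓ} (R? : Decidable R) (R-equiv : IsEquivalence R) where
  open IsEquivalence R-equiv using () renaming (refl to R-refl; sym to R-sym; trans to R-trans)

  IsLeast : Fin n → Set ℓ
  IsLeast r = ∀ u → R r u → toℕ r ≤ toℕ u

  least-in-class : ∀ v → ∃ λ r → R v r × IsLeast r
  least-in-class v with ¬∀⟶∃¬-smallest n (λ u → ¬ R v u) (λ u → ¬? (R? v u)) (λ ¬R → ¬R v R-refl)
  ... | r , ¬¬Rvr , below = r , Rvr , λ u Rru → ≮⇒≥ λ u<r →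
    below (fromℕ< u<r) (subst (R v) (sym (inject-fromℕ< u<r)) (R-trans Rvr Rru))
    where
    Rvr : R v r
    Rvr = decidable-stable (R? v r) ¬¬Rvr
    inject-fromℕ< : ∀ {u} (u<r : toℕ u < toℕ r) → inject (fromℕ< u<r) ≡ u
    inject-fromℕ< u<r = toℕ-injective (trans (toℕ-inject (fromℕ< u<r)) (toℕ-fromℕ< u<r))

  transversal : Transversal R
  transversal = record
    { size = length reps ; rep = lookup reps ; covers = covers ; separates = separates }
    where
    reps : List (Fin n)
    reps = filter (λ r → all? λ u → R? r u →-dec (toℕ r ≤? toℕ u)) (allFin n)
    covers : ∀ v → ∃ λ i → R (lookup reps i) v
    covers v with least-in-class v
    ... | r , Rvr , least = index r∈reps , subst (λ r → R r v) (lookup-index r∈reps) (R-sym Rvr)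
      where r∈reps = ∈-filter⁺ _ (∈-allFin r) least
    least-rep : ∀ i → IsLeast (lookup reps i)
    least-rep i = proj₂ (∈-filter⁻ _ {xs = allFin n} (∈-lookup i))
    separates : ∀ {i j v} → R (lookup reps i) v → R (lookup reps j) v → i ≡ j
    separates {i} {j} Riv Rjv = lookup-injective (filter⁺ _ (allFin⁺ n)) i j
      (toℕ-injective (≤-antisym (least-rep i _ (R-trans Riv (R-sym Rjv)))
                                 (least-rep j _ (R-trans Rjv (R-sym Riv)))))

module _ (G : Graph n) where
  open Graph G using (adj) renaming (sym to adj-sym; irrefl to adj-irrefl)

  infix 4 _∼_
  _∼_ : Fin n → Fin n → Set
  _∼_ = Adj G

  ∼-sym : x ∼ y → y ∼ x
  ∼-sym {x = x} {y = y} = subst T (adj-sym x y)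

  ∼-irrefl : ¬ x ∼ x
  ∼-irrefl {x = x} = subst T (adj-irrefl x)

  ∼⇒≢ : x ∼ y → x ≢ y
  ∼⇒≢ x∼x refl = ∼-irrefl x∼x

  _∼?_ : Decidable _∼_
  x ∼? y = T? (adj x y)

  ∈N⇒∼ : y ∈ N G x → x ∼ y
  ∈N⇒∼ {x = x} = x∈tabulate⇒T (adj x)

  ∼⇒∈N : x ∼ y → y ∈ N G x
  ∼⇒∈N {x = x} = T⇒x∈tabulate (adj x)

  ∈N[]⇒ : y ∈ N[_] G x → y ≡ x ⊎ x ∼ y
  ∈N[]⇒ {x = x} y∈ with Equivalence.to T-∨ (x∈tabulate⇒T (λ u → adj x u ∨ ⌊ u ≟ x ⌋) y∈)
  ... | inj₁ x∼y = inj₂ x∼y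
  ... | inj₂ y≡x = inj₁ (toWitness y≡x)

  ⇒∈N[] : y ≡ x ⊎ x ∼ y → y ∈ N[_] G x
  ⇒∈N[] {x = x} y≡x⊎x∼y = T⇒x∈tabulate (λ u → adj x u ∨ ⌊ u ≟ x ⌋) (Equivalence.from T-∨ (swap y≡x⊎x∼y))
    where
    swap : y ≡ x ⊎ x ∼ y → T (adj x y) ⊎ T ⌊ y ≟ x ⌋
    swap (inj₁ y≡x) = inj₂ (fromWitness y≡x)
    swap (inj₂ x∼y) = inj₁ x∼y

  ∈N[]-refl : x ∈ N[_] G x
  ∈N[]-refl = ⇒∈N[] (inj₁ refl)

  ∼⇒∈N[] : x ∼ y → y ∈ N[_] G x
  ∼⇒∈N[] = ⇒∈N[] ∘ inj₂

  ∈N[]-sym : y ∈ N[_] G x → x ∈ N[_] G y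
  ∈N[]-sym y∈ with ∈N[]⇒ y∈
  ... | inj₁ refl = ∈N[]-refl
  ... | inj₂ x∼y = ∼⇒∈N[] (∼-sym x∼y)

  Reach-closed : (P : Fin n → Set) → (∀ {u w} → P u → u ∼ w → P w) → Reach G x y → P x → P y
  Reach-closed P closed here         Px = Px
  Reach-closed P closed (step x∼ r) Px = Reach-closed P closed r (closed Px x∼)

  Triangle : Fin n → Fin n → Fin n → Set
  Triangle a b c = a ∼ b × a ∼ c × b ∼ c

  Triangle? : ∀ a b c → Dec (Triangle a b c)
  Triangle? a b c = a ∼? b ×-dec a ∼? c ×-dec b ∼? c

  Triangle-swap : ∀ {a b c} → Triangle a b c → Triangle b a c
  Triangle-swap (ab , ac , bc) = ∼-sym ab , bc , ac

  Triangle-rotate : ∀ {a b c} → Triangle a b c → Triangle c a b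
  Triangle-rotate (ab , ac , bc) = ∼-sym ac , ∼-sym bc , ab

  Triangle-flip : ∀ {a b c} → Triangle a b c → Triangle a c b
  Triangle-flip (ab , ac , bc) = ac , ab , ∼-sym bc

  Triangle⇒Unique : ∀ {a b c} → Triangle a b c → Unique (a ∷ b ∷ c ∷ [])
  Triangle⇒Unique (ab , ac , bc) = ≢⇒Unique₃ (∼⇒≢ ab) (∼⇒≢ ac) (∼⇒≢ bc)

  InTriangle : Fin n → Set
  InTriangle v = ∃₂ (Triangle v)

  InTriangle? : ∀ v → Dec (InTriangle v)
  InTriangle? v = any? λ a → any? λ b → Triangle? v a b

  SameTriangle : Fin n → Fin n → Set
  SameTriangle v u = v ≡ u ⊎ ∃ (Triangle v u)

  SameTriangle? : Decidable SameTriangle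
  SameTriangle? v u = v ≟ u ⊎-dec any? (Triangle? v u)

  TouchesTriangle : Fin n → Set
  TouchesTriangle v = ∃ λ x → ∃₂ λ y p → Triangle x y p × v ∼ x × v ≢ y × v ≢ p

  N≡N⇒∼ : N G x ≡ N G y → x ∼ z → y ∼ z
  N≡N⇒∼ Nx≡Ny x∼z = ∈N⇒∼ (subst (_ ∈_) Nx≡Ny (∼⇒∈N x∼z))

  Twin : Fin n → Fin n → Set
  Twin x y = x ≢ y × N G x ≡ N G y

  N[]⊆N[]⇒≡ : IsSIC G ⊤ → N[_] G x ⊆ N[_] G y → x ≡ y
  N[]⊆N[]⇒≡ {x = x} {y = y} ⊤-SIC x⊆y =
    sym (Equivalence.to (proj₂ (⊤-SIC x) y) λ w w∈ → ∈N[]-sym (x⊆y (proj₁ (x∈p∩q⁻ _ _ w∈))))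

  Essential : Fin n → Set
  Essential v = ∃₂ λ x y → x ≢ y × N[_] G x - v ⊆ N[_] G y

  Essential? : ∀ v → Dec (Essential v)
  Essential? v = any? λ x → any? λ y → ¬? (x ≟ y) ×-dec (N[_] G x - v ⊆? N[_] G y)

  ¬Essential⇒IsSIC⊤-v : ∀ {v u} → v ∼ u → ¬ Essential v → IsSIC G (⊤ - v)
  ¬Essential⇒IsSIC⊤-v {v} {u} v∼u ¬essential x =
    nonempty , λ y → mk⇔ (identified y) λ { refl w w∈ → ∈N[]-sym (proj₁ (x∈p∩q⁻ _ _ w∈)) }
    where
    ∈code : ∀ {w} → w ∈ N[_] G x → w ≢ v → w ∈ NS[_] G (⊤ - v) x
    ∈code w∈ w≢v = x∈p∩q⁺ (w∈ , x∈p∧x≢y⇒x∈p-y ∈⊤ w≢v)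
    nonempty : ∃ λ w → w ∈ NS[_] G (⊤ - v) x
    nonempty with x ≟ v
    ... | no x≢v   = x , ∈code ∈N[]-refl x≢v
    ... | yes refl = u , ∈code (∼⇒∈N[] v∼u) (≢-sym (∼⇒≢ v∼u))
    identified : ∀ y → (∀ w → w ∈ NS[_] G (⊤ - v) x → y ∈ N[_] G w) → y ≡ x
    identified y y∈⋂ with y ≟ x
    ... | yes y≡x = y≡x
    ... | no y≢x = ⊥-elim (¬essential (x , y , ≢-sym y≢x , λ w∈ →
            ∈N[]-sym (y∈⋂ _ (∈code (x∈p-y⇒x∈p w∈) (x∈p-y⇒x≢y w∈)))))

  module _ (cubic : Cubic G) where

    three-neighbours : ∀ v → ∃ λ a → ∃₂ λ b c → Unique (a ∷ b ∷ c ∷ []) × v ∼ a × v ∼ b × v ∼ c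
    three-neighbours v
      with a , a∈N ← ∣p∣≡1+k⇒Nonempty (N G v) (cubic v)
      with b , c , abc , b∈N , c∈N ← ∣p∣≡3⇒triple (cubic v) a∈N
      = a , b , c , abc , ∈N⇒∼ a∈N , ∈N⇒∼ b∈N , ∈N⇒∼ c∈N

    neighbours-among : ∀ {v a b c z} → Unique (a ∷ b ∷ c ∷ []) → v ∼ a → v ∼ b → v ∼ c → v ∼ z →
                       z ∈ₗ a ∷ b ∷ c ∷ []
    neighbours-among {v} abc va vb vc vz =
      length≥∣p∣⇒p⊆xs abc (∼⇒∈N va ∷ ∼⇒∈N vb ∷ ∼⇒∈N vc ∷ []) (≤-reflexive (cubic v)) (∼⇒∈N vz)

    neighbour-avoiding : ∀ v s t → ∃ λ e → v ∼ e × e ≢ s × e ≢ t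
    neighbour-avoiding v s t with any? (λ e → v ∼? e ×-dec ¬? (e ≟ s) ×-dec ¬? (e ≟ t))
    ... | yes found = found
    ... | no none = contradiction (subst (_≤ 2) (cubic v) (∣p∣≤length (s ∷ t ∷ []) N⊆st)) (<⇒≱ ≤-refl)
      where
      N⊆st : ∀ {e} → e ∈ N G v → e ∈ₗ s ∷ t ∷ []
      N⊆st {e} e∈N with e ≟ s | e ≟ t
      ... | yes e≡s | _       = here e≡s
      ... | no _    | yes e≡t = there (here e≡t)
      ... | no e≢s  | no e≢t  = ⊥-elim (none (e , ∈N⇒∼ e∈N , e≢s , e≢t))

    N⊆N⇒N≡N : N G x ⊆ N G y → N G x ≡ N G y
    N⊆N⇒N≡N {x = x} {y = y} x⊆y =
      ⊆-antisym x⊆y (p⊆q∧∣q∣≤∣p∣⇒q⊆p x⊆y (≤-reflexive (trans (cubic y) (sym (cubic x)))))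

    module _ (twin : ∀ v → ∃ (Twin v)) where

      neighbours-share-N : ∀ {x a b c} → Unique (a ∷ b ∷ c ∷ []) → x ∼ a → x ∼ b → x ∼ c →
                           N G a ≡ N G b × N G a ≡ N G c
      neighbours-share-N {x} {a} {b} {c} abc xa xb xc = share (partner xa) (partner xb) (partner xc)
        where
        Partner : Fin n → Set
        Partner t = ∃ λ t' → Twin t t' × t' ∈ₗ a ∷ b ∷ c ∷ []
        partner : ∀ {t} → x ∼ t → Partner t
        partner {t} x∼t with t' , t≢t' , Nt≡Nt' ← twin t =
          t' , (t≢t' , Nt≡Nt') , neighbours-among abc xa xb xc (∼-sym (N≡N⇒∼ Nt≡Nt' (∼-sym x∼t)))
        share : Partner a → Partner b → Partner c → N G a ≡ N G b × N G a ≡ N G c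
        share (_ , (a≢ , _) , here refl) _ _                                = ⊥-elim (a≢ refl)
        share _ (_ , (b≢ , _) , there (here refl)) _                        = ⊥-elim (b≢ refl)
        share _ _ (_ , (c≢ , _) , there (there (here refl)))                = ⊥-elim (c≢ refl)
        share (_ , (_ , Na≡Nb) , there (here refl)) _ (_ , (_ , Nc≡Na) , here refl) =
          Na≡Nb , sym Nc≡Na
        share (_ , (_ , Na≡Nb) , there (here refl)) _ (_ , (_ , Nc≡Nb) , there (here refl)) =
          Na≡Nb , trans Na≡Nb (sym Nc≡Nb)
        share (_ , (_ , Na≡Nc) , there (there (here refl))) (_ , (_ , Nb≡Na) , here refl) _ =
          sym Nb≡Na , Na≡Nc
        share (_ , (_ , Na≡Nc) , there (there (here refl))) (_ , (_ , Nb≡Nc) , there (there (here refl))) _ =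
          trans Na≡Nc (sym Nb≡Nc) , Na≡Nc

      -- The component of x is K₃,₃ with sides {x, x', w} and {a, b, c}.
      twins⇒n≤6 : Connected G → Fin n → n ≤ 6
      twins⇒n≤6 connected x
        with a , b , c , abc , xa , xb , xc ← three-neighbours x
        with x' , x≢x' , Nx≡Nx' ← twin x
        with Na≡Nb , Na≡Nc ← neighbours-share-N abc xa xb xc
        with w , aw , w≢x , w≢x' ← neighbour-avoiding a x x'
        = subst (_≤ 6) (∣⊤∣≡n n)
            (∣p∣≤length {p = ⊤} K λ {z} _ → Reach-closed (_∈ₗ K) K-closed (connected x z) (here refl))
        where
        K : List (Fin n)
        K = (x ∷ x' ∷ w ∷ []) ++ (a ∷ b ∷ c ∷ [])
        ax' : a ∼ x'
        ax' = ∼-sym (N≡N⇒∼ Nx≡Nx' xa)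
        xx'w : Unique (x ∷ x' ∷ w ∷ [])
        xx'w = ≢⇒Unique₃ x≢x' (≢-sym w≢x) (≢-sym w≢x')
        from-x : ∀ {z} → x ∼ z → z ∈ₗ K
        from-x xz = ++⁺ʳ (x ∷ x' ∷ w ∷ []) (neighbours-among abc xa xb xc xz)
        from-a : ∀ {z} → a ∼ z → z ∈ₗ K
        from-a az = ++⁺ˡ (neighbours-among xx'w (∼-sym xa) ax' aw az)
        K-closed : ∀ {u z} → u ∈ₗ K → u ∼ z → z ∈ₗ K
        K-closed (here refl)                                 = from-x
        K-closed (there (here refl))                         = from-x ∘ N≡N⇒∼ (sym Nx≡Nx')
        K-closed (there (there (here refl)))                 =
          ++⁺ʳ (x ∷ x' ∷ w ∷ []) ∘
            neighbours-among abc (∼-sym aw) (∼-sym (N≡N⇒∼ Na≡Nb aw)) (∼-sym (N≡N⇒∼ Na≡Nc aw))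
        K-closed (there (there (there (here refl))))         = from-a
        K-closed (there (there (there (there (here refl))))) = from-a ∘ N≡N⇒∼ (sym Na≡Nb)
        K-closed (there (there (there (there (there (here refl)))))) = from-a ∘ N≡N⇒∼ (sym Na≡Nc)

    triangle-neighbour∈SIC : ∀ {S u w w' v} → IsSIC G S → Triangle u w w' →
                             u ∼ v → v ≢ w → v ≢ w' → v ∈ S
    triangle-neighbour∈SIC {S} {u} {w} {w'} {v} sic (uw , uw' , ww') uv v≢w v≢w' with v ∈? S
    ... | yes v∈S = v∈S
    ... | no v∉S = ⊥-elim (∼⇒≢ uw (sym (Equivalence.to (proj₂ (sic u) w) w∈⋂)))
      where
      w∈⋂ : ∀ z → z ∈ NS[_] G S u → w ∈ N[_] G z
      w∈⋂ z z∈ with ∈N[]⇒ (proj₁ (x∈p∩q⁻ _ _ z∈))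
      ... | inj₁ refl = ∼⇒∈N[] uw
      ... | inj₂ uz with neighbours-among (≢⇒Unique₃ v≢w v≢w' (∼⇒≢ ww')) uv uw uw' uz
      ...   | here refl                 = ⊥-elim (v∉S (proj₂ (x∈p∩q⁻ _ _ z∈)))
      ...   | there (here refl)         = ∈N[]-refl
      ...   | there (there (here refl)) = ∼⇒∈N[] (∼-sym ww')

    TrianglePartition⇒⊤⊆SIC : ∀ {S} → TrianglePartition G → IsSIC G S → ∀ v → v ∈ S
    TrianglePartition⇒⊤⊆SIC (_ , B , covers , disjoint , size , clique) sic v
      with i , v∈Bi ← covers v
      with p , q , vpq , p∈Bi , q∈Bi ← ∣p∣≡3⇒triple (size i) v∈Bi
      with u , vu , u≢p , u≢q ← neighbour-avoiding v p q
      with j , u∈Bj ← covers u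
      with w , w' , (u≢w ∷ u≢w' ∷ []) ∷ (w≢w' ∷ []) ∷ _ , w∈Bj , w'∈Bj ← ∣p∣≡3⇒triple (size j) u∈Bj
      = triangle-neighbour∈SIC sic triangle (∼-sym vu) (λ { refl → v∉Bj w∈Bj }) (λ { refl → v∉Bj w'∈Bj })
      where
      triangle : Triangle u w w'
      triangle = clique j u w u∈Bj w∈Bj u≢w , clique j u w' u∈Bj w'∈Bj u≢w' , clique j w w' w∈Bj w'∈Bj w≢w'
      u∉Bi : u ∉ B i
      u∉Bi u∈Bi with length≥∣p∣⇒p⊆xs vpq (v∈Bi ∷ p∈Bi ∷ q∈Bi ∷ []) (≤-reflexive (size i)) u∈Bi
      ... | here refl                 = ∼⇒≢ vu refl
      ... | there (here refl)         = u≢p refl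
      ... | there (there (here refl)) = u≢q refl
      v∉Bj : v ∉ B j
      v∉Bj v∈Bj = u∉Bi (subst (λ k → u ∈ B k) (disjoint v j i v∈Bj v∈Bi) u∈Bj)

    TrianglePartition⇒SICNumber≡n : ∀ {k} → TrianglePartition G → IsSICNumber G k → k ≡ n
    TrianglePartition⇒SICNumber≡n {k} partition ((S , sic , ∣S∣≡k) , _) = begin
      k      ≡⟨ sym ∣S∣≡k ⟩
      ∣ S ∣  ≡⟨ cong ∣_∣ (⊆-antisym ⊆⊤ (λ {v} _ → TrianglePartition⇒⊤⊆SIC partition sic v)) ⟩
      ∣ ⊤ {n} ∣  ≡⟨ ∣⊤∣≡n n ⟩
      n      ∎
      where open ≡-Reasoning

    SICNumber≡n⇒Essential : IsSICNumber G n → ∀ v → Essential v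
    SICNumber≡n⇒Essential (_ , minimal) v with Essential? v
    ... | yes essential = essential
    ... | no ¬essential with a , _ , _ , _ , va , _ ← three-neighbours v =
      contradiction (subst (∣ ⊤ - v ∣ <_) (∣⊤∣≡n n) (x∈p⇒∣p-x∣<∣p∣ {x = v} {p = ⊤} ∈⊤))
                    (≤⇒≯ (minimal (⊤ - v) (¬Essential⇒IsSIC⊤-v va ¬essential)))

    adjacent-witnesses⇒TouchesTriangle : ∀ {v x y} → x ∼ y → N[_] G x - v ⊆ N[_] G y →
                                       v ∈ N[_] G x → v ∉ N[_] G y → TouchesTriangle v
    adjacent-witnesses⇒TouchesTriangle {v} {x} {y} xy x⊆y v∈N[x] v∉N[y]
      with p , xp , p≢y , p≢v ← neighbour-avoiding x y v
      = x , y , p , (xy , xp , yp) , vx , (λ { refl → v∉N[y] ∈N[]-refl }) , ≢-sym p≢v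
      where
      vx : v ∼ x
      vx with ∈N[]⇒ v∈N[x]
      ... | inj₁ refl = ⊥-elim (v∉N[y] (∼⇒∈N[] (∼-sym xy)))
      ... | inj₂ xv = ∼-sym xv
      yp : y ∼ p
      yp with ∈N[]⇒ (x⊆y (x∈p∧x≢y⇒x∈p-y (∼⇒∈N[] xp) p≢v))
      ... | inj₁ p≡y = ⊥-elim (p≢y p≡y)
      ... | inj₂ yp = yp

    nonadjacent-witnesses⇒Twin : ∀ {v x y} → x ≢ y → ¬ x ∼ y → N[_] G x - v ⊆ N[_] G y → ∃ (Twin v)
    nonadjacent-witnesses⇒Twin {v} {x} {y} x≢y x≁y x⊆y with x ≟ v
    ... | yes refl = y , x≢y , N⊆N⇒N≡N Nx⊆Ny
      where
      Nx⊆Ny : N G x ⊆ N G y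
      Nx⊆Ny = ∼⇒∈N ∘ x∼⇒y∼ ∘ ∈N⇒∼
        where
        x∼⇒y∼ : ∀ {z} → x ∼ z → y ∼ z
        x∼⇒y∼ xz with ∈N[]⇒ (x⊆y (x∈p∧x≢y⇒x∈p-y (∼⇒∈N[] xz) (≢-sym (∼⇒≢ xz))))
        ... | inj₁ refl = ⊥-elim (x≁y xz)
        ... | inj₂ yz = yz
    ... | no x≢v with ∈N[]⇒ (x⊆y (x∈p∧x≢y⇒x∈p-y ∈N[]-refl x≢v))
    ...   | inj₁ x≡y = ⊥-elim (x≢y x≡y)
    ...   | inj₂ yx = ⊥-elim (x≁y (∼-sym yx))

    module _ (⊤-SIC : IsSIC G ⊤) where

      no-diamond : ∀ {p q r s} → p ∼ q → p ∼ r → q ∼ r → p ∼ s → q ∼ s → r ≢ s → ⊥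
      no-diamond {p} {q} {r} {s} pq pr qr ps qs r≢s = ∼⇒≢ pq (N[]⊆N[]⇒≡ ⊤-SIC N[p]⊆N[q])
        where
        N[p]⊆N[q] : N[_] G p ⊆ N[_] G q
        N[p]⊆N[q] z∈ with ∈N[]⇒ z∈
        ... | inj₁ refl = ∼⇒∈N[] (∼-sym pq)
        ... | inj₂ pz with neighbours-among (≢⇒Unique₃ (∼⇒≢ qr) (∼⇒≢ qs) r≢s) pq pr ps pz
        ...   | here refl                 = ∈N[]-refl
        ...   | there (here refl)         = ∼⇒∈N[] qr
        ...   | there (there (here refl)) = ∼⇒∈N[] qs

      Triangle-unique : ∀ {t a b c d} → Triangle t a b → Triangle t c d → c ≡ a ⊎ c ≡ b
      Triangle-unique {a = a} {b} {c} (ta , tb , ab) (tc , td , cd) with c ≟ a | c ≟ b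
      ... | yes c≡a | _       = inj₁ c≡a
      ... | no _    | yes c≡b = inj₂ c≡b
      ... | no c≢a  | no c≢b
        with neighbours-among (≢⇒Unique₃ (∼⇒≢ ab) (≢-sym c≢a) (≢-sym c≢b)) ta tb tc td
      ...   | here refl                 = ⊥-elim (no-diamond ta tb ab tc (∼-sym cd) (≢-sym c≢b))
      ...   | there (here refl)         = ⊥-elim (no-diamond tb ta (∼-sym ab) tc (∼-sym cd) (≢-sym c≢a))
      ...   | there (there (here refl)) = ⊥-elim (∼-irrefl cd)

      N[x]-v⊆N[y]⇒v∈N[x]∖N[y] : ∀ {v x y} → x ≢ y → N[_] G x - v ⊆ N[_] G y →
                                v ∈ N[_] G x × v ∉ N[_] G y
      N[x]-v⊆N[y]⇒v∈N[x]∖N[y] {v} {x} {y} x≢y x⊆y =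
        v∈N[x] , λ v∈N[y] → x≢y (N[]⊆N[]⇒≡ ⊤-SIC (grow (inj₂ v∈N[y])))
        where
        grow : v ∉ N[_] G x ⊎ v ∈ N[_] G y → N[_] G x ⊆ N[_] G y
        grow v-ok {z} z∈ with z ≟ v | v-ok
        ... | no z≢v  | _               = x⊆y (x∈p∧x≢y⇒x∈p-y z∈ z≢v)
        ... | yes refl | inj₁ v∉N[x]    = ⊥-elim (v∉N[x] z∈)
        ... | yes refl | inj₂ v∈N[y]    = v∈N[y]
        v∈N[x] : v ∈ N[_] G x
        v∈N[x] with v ∈? N[_] G x
        ... | yes v∈ = v∈
        ... | no v∉  = ⊥-elim (x≢y (N[]⊆N[]⇒≡ ⊤-SIC (grow (inj₁ v∉))))

      Essential⇒TouchesTriangle⊎Twin : ∀ {v} → Essential v → TouchesTriangle v ⊎ ∃ (Twin v)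
      Essential⇒TouchesTriangle⊎Twin (x , y , x≢y , x⊆y) with x ∼? y
      ... | yes xy =
        inj₁ (uncurry (adjacent-witnesses⇒TouchesTriangle xy x⊆y) (N[x]-v⊆N[y]⇒v∈N[x]∖N[y] x≢y x⊆y))
      ... | no x≁y = inj₂ (nonadjacent-witnesses⇒Twin x≢y x≁y x⊆y)

      module _ (essential : ∀ v → Essential v) where

        InTriangle-step : ∀ {v u} → InTriangle v → v ∼ u → InTriangle u
        InTriangle-step {v} {u} (a , b , vab@(va , vb , ab)) vu with u ≟ a | u ≟ b
        ... | yes refl | _        = v , b , Triangle-swap vab
        ... | no _     | yes refl = v , a , Triangle-rotate vab
        ... | no u≢a   | no u≢b   with Essential⇒TouchesTriangle⊎Twin (essential v)
        ...   | inj₂ (y , v≢y , Nv≡Ny) = ⊥-elim (no-diamond ab (∼-sym va) (∼-sym vb) (a∼y va) (a∼y vb) v≢y)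
          where
          a∼y : ∀ {a} → v ∼ a → a ∼ y
          a∼y = ∼-sym ∘ N≡N⇒∼ Nv≡Ny
        ...   | inj₁ (x , y , p , xyp , vx , v≢y , v≢p)
          with neighbours-among (≢⇒Unique₃ (∼⇒≢ ab) (≢-sym u≢a) (≢-sym u≢b)) va vb vu vx
        ...     | here refl                 = ⊥-elim ([ v≢y , v≢p ]′ (Triangle-unique xyp (Triangle-swap vab)))
        ...     | there (here refl)         = ⊥-elim ([ v≢y , v≢p ]′ (Triangle-unique xyp (Triangle-rotate vab)))
        ...     | there (there (here refl)) = y , p , xyp

        all-in-triangles : Connected G → 6 < n → ∀ v → InTriangle v
        all-in-triangles connected 6<n v with any? InTriangle?
        ... | yes (u , u∈△) = Reach-closed InTriangle InTriangle-step (connected u v) u∈△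
        ... | no none = contradiction (twins⇒n≤6 twin connected (fromℕ< (≤-trans (s≤s z≤n) 6<n))) (<⇒≱ 6<n)
          where
          twin : ∀ v → ∃ (Twin v)
          twin v with Essential⇒TouchesTriangle⊎Twin (essential v)
          ... | inj₁ (x , y , p , xyp , _) = ⊥-elim (none (x , y , p , xyp))
          ... | inj₂ twin = twin

      SameTriangle-isEquivalence : IsEquivalence SameTriangle
      SameTriangle-isEquivalence = record
        { refl  = inj₁ refl
        ; sym   = λ { (inj₁ refl) → inj₁ refl ; (inj₂ (w , vuw)) → inj₂ (w , Triangle-swap vuw) }
        ; trans = trans′
        }
        where
        trans′ : ∀ {v u z} → SameTriangle v u → SameTriangle u z → SameTriangle v z
        trans′ (inj₁ refl) u~z = u~z
        trans′ v~u (inj₁ refl) = v~u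
        trans′ (inj₂ (w , vuw)) (inj₂ (w' , uzw')) with Triangle-unique (Triangle-swap vuw) uzw'
        ... | inj₁ refl = inj₁ refl
        ... | inj₂ refl = inj₂ (_ , Triangle-flip vuw)

      triangle-partition : (∀ v → InTriangle v) → TrianglePartition G
      triangle-partition in-triangle = size , B , covers′ , disjoint , card , clique
        where
        open Transversal (transversal SameTriangle? SameTriangle-isEquivalence)
        open IsEquivalence SameTriangle-isEquivalence using () renaming (sym to ~-sym; trans to ~-trans)
        B : Fin size → Subset n
        B i = tabulate λ u → ⌊ SameTriangle? (rep i) u ⌋
        ∈B⇒ : ∀ {i u} → u ∈ B i → SameTriangle (rep i) u
        ∈B⇒ {i} u∈ = toWitness (x∈tabulate⇒T (λ u → ⌊ SameTriangle? (rep i) u ⌋) u∈)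
        ⇒∈B : ∀ {i u} → SameTriangle (rep i) u → u ∈ B i
        ⇒∈B {i} r~u = T⇒x∈tabulate (λ u → ⌊ SameTriangle? (rep i) u ⌋) (fromWitness r~u)
        covers′ : ∀ v → ∃ λ i → v ∈ B i
        covers′ v with i , r~v ← covers v = i , ⇒∈B r~v
        disjoint : ∀ v i j → v ∈ B i → v ∈ B j → i ≡ j
        disjoint v i j v∈Bi v∈Bj = separates (∈B⇒ v∈Bi) (∈B⇒ v∈Bj)
        card : ∀ i → ∣ B i ∣ ≡ 3
        card i with a , b , rab ← in-triangle (rep i) =
          ≤-antisym (∣p∣≤length (rep i ∷ a ∷ b ∷ []) Bi⊆rab)
                    (length≤∣p∣ (Triangle⇒Unique rab)
                                (⇒∈B (inj₁ refl) ∷ ⇒∈B (inj₂ (b , rab)) ∷ ⇒∈B (inj₂ (a , Triangle-flip rab)) ∷ []))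
          where
          Bi⊆rab : ∀ {u} → u ∈ B i → u ∈ₗ rep i ∷ a ∷ b ∷ []
          Bi⊆rab u∈ with ∈B⇒ u∈
          ... | inj₁ refl = here refl
          ... | inj₂ (_ , ruw) = there ([ here , (λ u≡b → there (here u≡b)) ]′ (Triangle-unique rab ruw))
        clique : ∀ i u w → u ∈ B i → w ∈ B i → u ≢ w → u ∼ w
        clique i u w u∈ w∈ u≢w with ~-trans (~-sym (∈B⇒ u∈)) (∈B⇒ w∈)
        ... | inj₁ u≡w = ⊥-elim (u≢w u≡w)
        ... | inj₂ (_ , uw , _) = uw

    SICNumber≡n⇒TrianglePartition : Connected G → 6 < n → IsSICNumber G n → TrianglePartition G
    SICNumber≡n⇒TrianglePartition connected 6<n sic-number =
      triangle-partition ⊤-SIC (all-in-triangles ⊤-SIC (SICNumber≡n⇒Essential sic-number) connected 6<n)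
      where
      ⊤-SIC : IsSIC G ⊤
      ⊤-SIC with S , sic , ∣S∣≡n ← proj₁ sic-number = subst (IsSIC G) (∣p∣≡n⇒p≡⊤ ∣S∣≡n) sic

-- The hypothesis HasSIC G is implied by IsSICNumber G k.
mainTheorem12 : (n : ℕ) → 8 ≤ n → (G : Graph n) → Connected G → Cubic G →
    HasSIC G → (k : ℕ) → IsSICNumber G k → (k ≡ n ⇔ TrianglePartition G)
mainTheorem12 n 8≤n G connected cubic _ k sic-number = mk⇔
  (λ { refl → SICNumber≡n⇒TrianglePartition G cubic connected (≤-trans (n≤1+n 7) 8≤n) sic-number })
  (λ partition → TrianglePartition⇒SICNumber≡n G cubic partition sic-number)
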